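{- Let $\mathcal D$ be a nonempty Ferrers diagram. Then the pair $(\mathcal D,3)$ is irreducible if and only if $$\mathcal D\in\{\mathcal A_n,\mathcal G_n: n\ge3\}\cup\{\mathcal E_n,\mathcal F_n: n\ge4\}.$$
   Context: $\mathbb N=\{1,2,\dots\}$, $[n]=\{1,\dots,n\}$. A Ferrers diagram is a finite set $\mathcal D\subseteq\mathbb N^2$ such that $(x,y)\in\mathcal D$ implies $(i,j)\in\mathcal D$ for all $i\in[x]$, $j\in[y]$ (first coordinate row, second column); it is described by its column heights $(c_1,c_2,\dots)$, $c_j=|\mathcal D\cap(\mathbb N\times\{j\})|$ (trailing zero columns omitted). $\mathcal A_n=[n]^2$; $\mathcal G_n$ has column heights $(n,\underbrace{n-1,\dots,n-1}_{n-2},1)$; $\mathcal E_n$ has column heights $(\underbrace{n-1,\dots,n-1}_{n-2},1,1)$; $\mathcal F_n$ has column heights $(n,\underbrace{n-2,\dots,n-2}_{n-2})$. For $0\le j\le d-1$, $\nu_j(\mathcal D,d)=|\{(x,y)\in\mathcal D: x\ge d-j,\ y\ge j+1\}|$ and $\nu_{\min}(\mathcal D,d)=\min_j\nu_j(\mathcal D,d)$. For $P\in\mathcal D$ such that $\mathcal D'=\mathcal D\setminus\{P\}$ is a Ferrers diagram: if $\nu_{\min}(\mathcal D',d)=\nu_{\min}(\mathcal D,d)$ write $\mathcal D'\xrightarrow{d}\mathcal D$, otherwise $\mathcal D\xrightarrow{d}\mathcal D'$. $(\mathcal D,d)$ is irreducible if there is no Ferrers diagram $\mathcal D'$ with $\mathcal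 D'\xrightarrow{d}\mathcal D$. -}

module Defs where

open import Data.Nat using (ℕ; zero; suc; _≤_; _≥_; _∸_; _⊓_; _≤?_)
open import Data.List using (List; []; _∷_; _++_; replicate; length; filter; concat; map; applyUpTo; [_])
open import Data.Product using (_×_; _,_; ∃; ∃-syntax; proj₁; proj₂)
open import Data.Sum using (_⊎_)
open import Relation.Binary.PropositionalEquality using (_≡_; _≢_)
open import Relation.Nullary using (¬_)
open import Relation.Unary using (Decidable)

-- A Ferrers diagram is represented by its list of column heights (c₁, c₂, …, c_m)
-- (trailing zero columns omitted): all heights positive and nonincreasing.
data Nonincreasing : List ℕ → Set where
  ni-[]  : Nonincreasing []
  ni-[_] : ∀ a → Nonincreasing [ a ]
  ni-∷   : ∀ {a b cs} → b ≤ a → Nonincreasing (b ∷ cs) → Nonincreasing (a ∷ b ∷ cs)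

data AllPositive : List ℕ → Set where
  ap-[] : AllPositive []
  ap-∷  : ∀ {a cs} → 1 ≤ a → AllPositive cs → AllPositive (a ∷ cs)

IsFerrers : List ℕ → Set
IsFerrers cs = Nonincreasing cs × AllPositive cs

-- height of column y (1-indexed); 0 if out of range
height : List ℕ → ℕ → ℕ
height []       _             = 0
height (c ∷ cs) zero          = 0
height (c ∷ cs) (suc zero)    = c
height (c ∷ cs) (suc (suc y)) = height cs (suc y)

-- cell (x , y) : x = row, y = column
Cell : Set
Cell = ℕ × ℕ

_∈D_ : Cell → List ℕ → Set
(x , y) ∈D cs = (1 ≤ x) × (1 ≤ y) × (x ≤ height cs y)

IsRemoval : List ℕ → Cell → List ℕ → Set
IsRemoval D P D' = P ∈D D × (∀ Q → (Q ∈D D' → (Q ∈D D × Q ≢ P)) × ((Q ∈D D × Q ≢ P) → Q ∈D D'))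

cellsFrom : ℕ → List ℕ → List Cell
cellsFrom y []       = []
cellsFrom y (c ∷ cs) = applyUpTo (λ i → (suc i , y)) c ++ cellsFrom (suc y) cs

cells : List ℕ → List Cell
cells = cellsFrom 1

νpred : (j d : ℕ) → Decidable (λ (P : Cell) → (proj₁ P ≥ d ∸ j) × (proj₂ P ≥ suc j))
νpred j d (x , y) with d ∸ j ≤? x | suc j ≤? y
... | Relation.Nullary.yes p | Relation.Nullary.yes q = Relation.Nullary.yes (p , q)
... | Relation.Nullary.no ¬p | _ = Relation.Nullary.no (λ r → ¬p (proj₁ r))
... | Relation.Nullary.yes _ | Relation.Nullary.no ¬q = Relation.Nullary.no (λ r → ¬q (proj₂ r))

ν : ℕ → List ℕ → ℕ → ℕ
ν j D d = length (filter (νpred j d) (cells D))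

νminUpTo : List ℕ → ℕ → ℕ → ℕ
νminUpTo D d zero    = ν 0 D d
νminUpTo D d (suc k) = νminUpTo D d k ⊓ ν (suc k) D d

-- ν_min(D,d) = min_{0 ≤ j ≤ d-1} ν_j(D,d)   (only meaningful for d ≥ 1)
νmin : List ℕ → ℕ → ℕ
νmin D zero    = 0
νmin D (suc k) = νminUpTo D (suc k) k

-- D' →_d D (both Ferrers diagrams), literally as in the paper:
--  either D' = D ∖ {P} and ν_min(D',d) = ν_min(D,d),
--  or     D = D' ∖ {P} and ν_min(D,d) ≠ ν_min(D',d).
Arrow : ℕ → List ℕ → List ℕ → Set
Arrow d D' D =
  (∃[ P ] IsRemoval D P D' × νmin D' d ≡ νmin D d)
  ⊎ (∃[ P ] IsRemoval D' P D × νmin D d ≢ νmin D' d)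

Irreducible : List ℕ → ℕ → Set
Irreducible D d = ¬ (∃[ D' ] IsFerrers D' × Arrow d D' D)

𝒜 : ℕ → List ℕ
𝒜 n = replicate n n

𝒢 : ℕ → List ℕ
𝒢 n = n ∷ replicate (n ∸ 2) (n ∸ 1) ++ [ 1 ]

ℰ : ℕ → List ℕ
ℰ n = replicate (n ∸ 2) (n ∸ 1) ++ 1 ∷ 1 ∷ []

ℱ : ℕ → List ℕ
ℱ n = n ∷ replicate (n ∸ 2) (n ∸ 2)

InFamily : List ℕ → Set
InFamily D =
  (∃[ n ] 3 ≤ n × (D ≡ 𝒜 n ⊎ D ≡ 𝒢 n))
  ⊎ (∃[ n ] 4 ≤ n × (D ≡ ℰ n ⊎ D ≡ ℱ n))

-- For d = 3, ν₀ counts the cells in rows ≥ 3, ν₁ those in rows and columns ≥ 2, and ν₂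
-- those in columns ≥ 3.  (D, 3) is irreducible iff removing any corner lowers ν_min and
-- adding any cell keeps it.  A cell added in row and column ≥ 3 raises all three counts,
-- so after column 2 an irreducible diagram can only drop to height ≤ 1: it is a hook
-- (then ν₁ = 0, whereas irreducibility forces ν_min > 0) or a staircase with a first column
-- of height q + 2, then t + 1 columns of height p + 2 and u columns of height 1.  There
-- (ν₀, ν₁, ν₂) = (q + p, p + t + 1, 2t + u) + tp, and six explicit moves force ν₀ = ν₂ ≤ ν₁,
-- a linear condition whose solutions with p ≤ q are exactly the staircases 𝒜ₙ, 𝒢ₙ, ℰₙ, ℱₙ
-- and the 2 × 2 square, which has ν₀ = 0.
-- Conversely, on 𝒜ₙ, 𝒢ₙ, ℰₙ, ℱₙ every corner is counted by a minimal ν_j and every addable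
-- cell is missed by one, which makes them irreducible.
module Submission where

open import Data.Empty using (⊥)
open import Data.List using (List; []; _∷_; _++_; [_]; length; replicate; filter; applyUpTo)
open import Data.List.Properties using (applyUpTo-∷ʳ; filter-accept; filter-reject; filter-++; length-++; ++-identityʳ)
open import Data.Nat
open import Data.Nat.Properties
open import Data.Nat.Tactic.RingSolver using (solve-∀)
open import Algebra.Properties.CommutativeSemigroup +-commutativeSemigroup using (x∙yz≈y∙xz; xy∙z≈y∙xz)
open import Data.Product using (_×_; _,_; proj₁; proj₂; ∃-syntax)
open import Data.Sum using (_⊎_; inj₁; inj₂)
open import Data.Unit using (⊤; tt)
open import Defs
open import Function using (_∘_)
open import Relation.Binary.PropositionalEquality hiding ([_])
open import Relation.Nullary using (¬_; yes; no; contradiction)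
open import Relation.Nullary.Decidable using (decidable-stable)

private
  variable
    c d h i j k m n x y : ℕ
    D E L D⁺ D⁻ : List ℕ

-- Column heights and one-cell changes

-- Columns are numbered from 0 here: col D i is the height of the paper's column i + 1.
col : List ℕ → ℕ → ℕ
col D i = height D (suc i)

NonincreasingColumns : List ℕ → Set
NonincreasingColumns D = ∀ i → col D (suc i) ≤ col D i

Nonincreasing⇒NonincreasingColumns : Nonincreasing D → NonincreasingColumns D
Nonincreasing⇒NonincreasingColumns ni-[]         i       = z≤n
Nonincreasing⇒NonincreasingColumns ni-[ a ]      i       = z≤n
Nonincreasing⇒NonincreasingColumns (ni-∷ b≤a ni) zero    = b≤a
Nonincreasing⇒NonincreasingColumns (ni-∷ b≤a ni) (suc i) = Nonincreasing⇒NonincreasingColumns ni i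

NonincreasingColumns⇒Nonincreasing : AllPositive D → NonincreasingColumns D → Nonincreasing D
NonincreasingColumns⇒Nonincreasing ap-[]                  _    = ni-[]
NonincreasingColumns⇒Nonincreasing (ap-∷ _ ap-[])         _    = ni-[ _ ]
NonincreasingColumns⇒Nonincreasing (ap-∷ _ ap@(ap-∷ _ _)) desc =
  ni-∷ (desc 0) (NonincreasingColumns⇒Nonincreasing ap (desc ∘ suc))

col-positive⇒<length : ∀ D → 0 < col D i → i < length D
col-positive⇒<length {i}     []       ()
col-positive⇒<length {zero}  (c ∷ cs) _   = s≤s z≤n
col-positive⇒<length {suc i} (c ∷ cs) pos = s≤s (col-positive⇒<length cs pos)

col-injective : AllPositive D → AllPositive E → (∀ i → col D i ≡ col E i) → D ≡ E
col-injective ap-[]       ap-[]       _  = refl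
col-injective ap-[]       (ap-∷ p _)  eq = contradiction (eq 0) (<⇒≢ p)
col-injective (ap-∷ p _)  ap-[]       eq = contradiction (eq 0) (>⇒≢ p)
col-injective (ap-∷ _ pD) (ap-∷ _ pE) eq = cong₂ _∷_ (eq 0) (col-injective pD pE (eq ∘ suc))

record AddsCell (k : ℕ) (D D⁺ : List ℕ) : Set where
  constructor addsCell
  field
    grown : col D⁺ k ≡ suc (col D k)
    same  : ∀ i → i ≢ k → col D⁺ i ≡ col D i

Addable : ℕ → List ℕ → Set
Addable zero    D = ⊤
Addable (suc k) D = col D (suc k) < col D k

Corner : ℕ → List ℕ → Set
Corner k D = col D (suc k) < col D k

addsCell-[] : AddsCell 0 [] [ 1 ]
addsCell-[] = addsCell refl λ { zero 0≢0 → contradiction refl 0≢0 ; (suc i) _ → refl }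

addsCell-head : AddsCell 0 (c ∷ D) (suc c ∷ D)
addsCell-head = addsCell refl λ { zero 0≢0 → contradiction refl 0≢0 ; (suc i) _ → refl }

addsCell-∷ : AddsCell k D D⁺ → AddsCell (suc k) (c ∷ D) (c ∷ D⁺)
addsCell-∷ (addsCell grown same) = addsCell grown λ { zero _ → refl ; (suc i) i≢k → same i (i≢k ∘ cong suc) }

addsCell-unique : AddsCell k D E → AddsCell k D L → ∀ i → col E i ≡ col L i
addsCell-unique {k} (addsCell grownE sameE) (addsCell grownL sameL) i with i ≟ k
... | yes refl = trans grownE (sym grownL)
... | no i≢k   = trans (sameE i i≢k) (sym (sameL i i≢k))

addsCell⇒addable : NonincreasingColumns D⁺ → AddsCell k D D⁺ → Addable k D
addsCell⇒addable {k = zero}  _    _                     = tt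
addsCell⇒addable {k = suc k} desc (addsCell grown same) =
  ≤-trans (≤-reflexive (sym grown)) (≤-trans (desc k) (≤-reflexive (same k (<⇒≢ (n<1+n k)))))

addsCell⇒corner : NonincreasingColumns D⁻ → AddsCell k D⁻ D → Corner k D
addsCell⇒corner {k = k} desc (addsCell grown same) =
  ≤-trans (s≤s (≤-trans (≤-reflexive (same (suc k) (>⇒≢ (n<1+n k)))) (desc k))) (≤-reflexive (sym grown))

addsCell-nonincreasing⁺ : AddsCell k D D⁺ → NonincreasingColumns D → Addable k D → NonincreasingColumns D⁺
addsCell-nonincreasing⁺ {k} (addsCell grown same) desc addable i with i ≟ k | suc i ≟ k
... | yes refl | _        = subst₂ _≤_ (sym (same (suc i) (>⇒≢ (n<1+n i)))) (sym grown) (m≤n⇒m≤1+n (desc i))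
... | no i≢k   | yes refl = subst₂ _≤_ (sym grown) (sym (same i i≢k)) addable
... | no i≢k   | no 1+i≢k = subst₂ _≤_ (sym (same (suc i) 1+i≢k)) (sym (same i i≢k)) (desc i)

addsCell-nonincreasing⁻ : AddsCell k D D⁺ → NonincreasingColumns D⁺ → Corner k D⁺ → NonincreasingColumns D
addsCell-nonincreasing⁻ {k} (addsCell grown same) desc corner i with i ≟ k | suc i ≟ k
... | yes refl | _        = s≤s⁻¹ (subst₂ _<_ (same (suc i) (>⇒≢ (n<1+n i))) grown corner)
... | no i≢k   | yes refl = ≤-trans (n≤1+n _) (subst₂ _≤_ grown (same i i≢k) (desc i))
... | no i≢k   | no 1+i≢k = subst₂ _≤_ (same (suc i) 1+i≢k) (same i i≢k) (desc i)

-- Both are junk outside their intended range: addCell k D for k ≤ length D, removeCell k D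
-- at a corner k of a diagram with positive columns.
addCell : ℕ → List ℕ → List ℕ
addCell zero    []       = [ 1 ]
addCell zero    (c ∷ cs) = suc c ∷ cs
addCell (suc k) []       = []
addCell (suc k) (c ∷ cs) = c ∷ addCell k cs

removeCell : ℕ → List ℕ → List ℕ
removeCell zero    []                 = []
removeCell zero    (zero ∷ cs)        = zero ∷ cs
removeCell zero    (suc zero ∷ cs)    = cs
removeCell zero    (suc (suc c) ∷ cs) = suc c ∷ cs
removeCell (suc k) []                 = []
removeCell (suc k) (c ∷ cs)           = c ∷ removeCell k cs

addCell-addsCell : ∀ k D → k ≤ length D → AddsCell k D (addCell k D)
addCell-addsCell zero    []       _         = addsCell-[]
addCell-addsCell zero    (c ∷ cs) _         = addsCell-head
addCell-addsCell (suc k) (c ∷ cs) (s≤s k≤n) = addsCell-∷ (addCell-addsCell k cs k≤n)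

addCell-allPositive : ∀ k → AllPositive D → AllPositive (addCell k D)
addCell-allPositive zero    ap-[]       = ap-∷ (s≤s z≤n) ap-[]
addCell-allPositive zero    (ap-∷ _ ap) = ap-∷ (s≤s z≤n) ap
addCell-allPositive (suc k) ap-[]       = ap-[]
addCell-allPositive (suc k) (ap-∷ p ap) = ap-∷ p (addCell-allPositive k ap)

removeCell-addsCell : ∀ k → AllPositive D → Corner k D → AddsCell k (removeCell k D) D
removeCell-addsCell zero    (ap-∷ {suc zero} _ ap-[])        _         = addsCell-[]
removeCell-addsCell zero    (ap-∷ {suc zero} _ (ap-∷ 1≤c _)) (s≤s c<1) = contradiction 1≤c (<⇒≱ (s≤s c<1))
removeCell-addsCell zero    (ap-∷ {suc (suc c)} _ _)         _         = addsCell-head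
removeCell-addsCell (suc k) (ap-∷ _ ap)                      corner    = addsCell-∷ (removeCell-addsCell k ap corner)

removeCell-allPositive : ∀ k → AllPositive D → AllPositive (removeCell k D)
removeCell-allPositive zero    ap-[]                     = ap-[]
removeCell-allPositive zero    (ap-∷ {suc zero} _ ap)    = ap
removeCell-allPositive zero    (ap-∷ {suc (suc c)} _ ap) = ap-∷ (s≤s z≤n) ap
removeCell-allPositive (suc k) ap-[]                     = ap-[]
removeCell-allPositive (suc k) (ap-∷ p ap)               = ap-∷ p (removeCell-allPositive k ap)

addable⇒≤length : ∀ k D → Addable k D → k ≤ length D
addable⇒≤length zero    D _       = z≤n
addable⇒≤length (suc k) D addable = col-positive⇒<length D (≤-trans (s≤s z≤n) addable)

addsCell⇒≤length : NonincreasingColumns D⁺ → AddsCell k D D⁺ → k ≤ length D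
addsCell⇒≤length {k = k} {D = D} desc add = addable⇒≤length k D (addsCell⇒addable desc add)

addCell-isFerrers : ∀ k → IsFerrers D → Addable k D → IsFerrers (addCell k D)
addCell-isFerrers {D = D} k (ni , ap) addable = NonincreasingColumns⇒Nonincreasing ap⁺ desc⁺ , ap⁺
  where
  ap⁺ : AllPositive (addCell k D)
  ap⁺ = addCell-allPositive k ap
  desc⁺ : NonincreasingColumns (addCell k D)
  desc⁺ = addsCell-nonincreasing⁺ (addCell-addsCell k D (addable⇒≤length k D addable)) (Nonincreasing⇒NonincreasingColumns ni) addable

removeCell-isFerrers : ∀ k → IsFerrers D → Corner k D → IsFerrers (removeCell k D)
removeCell-isFerrers {D = D} k (ni , ap) corner = NonincreasingColumns⇒Nonincreasing ap⁻ desc⁻ , ap⁻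
  where
  ap⁻ : AllPositive (removeCell k D)
  ap⁻ = removeCell-allPositive k ap
  desc⁻ : NonincreasingColumns (removeCell k D)
  desc⁻ = addsCell-nonincreasing⁻ (removeCell-addsCell k ap corner) (Nonincreasing⇒NonincreasingColumns ni) corner

addsCell⇒≡addCell : IsFerrers D → IsFerrers D⁺ → AddsCell k D D⁺ → D⁺ ≡ addCell k D
addsCell⇒≡addCell {D = D} {k = k} (_ , ap) (ni⁺ , ap⁺) add =
  col-injective ap⁺ (addCell-allPositive k ap)
    (addsCell-unique add (addCell-addsCell k D (addsCell⇒≤length (Nonincreasing⇒NonincreasingColumns ni⁺) add)))

corner-exists : AllPositive D → D ≢ [] → ∃[ k ] Corner k D
corner-exists ap-[]                  D≢[] = contradiction refl D≢[]
corner-exists (ap-∷ 1≤c ap-[])       _    = 0 , 1≤c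
corner-exists (ap-∷ _ ap@(ap-∷ _ _)) _    = let k , corner = corner-exists ap (λ ()) in suc k , corner

segment-⊆⇒≤ : ∀ {a b} → (∀ y → 1 ≤ y → y ≤ a → y ≤ b) → a ≤ b
segment-⊆⇒≤ {zero}  _   = z≤n
segment-⊆⇒≤ {suc a} a⊆b = a⊆b (suc a) (s≤s z≤n) ≤-refl

punctured-segment : ∀ {a b} → 1 ≤ x → x ≤ a →
  (∀ y → 1 ≤ y → y ≤ b → y ≢ x) → (∀ y → 1 ≤ y → y ≤ a → y ≢ x → y ≤ b) → a ≡ suc b
punctured-segment {x} {a} {b} 1≤x x≤a missing covered = ≤-antisym (≮⇒≥ too-long) (<-≤-trans b<x x≤a)
  where
  b<x : b < x
  b<x = ≰⇒> λ x≤b → missing x 1≤x x≤b refl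
  too-long : suc b < a → ⊥
  too-long 1+b<a with suc b ≟ x
  ... | yes refl = <⇒≱ 1+b<a (≤-trans (covered a (≤-trans 1≤x x≤a) ≤-refl (>⇒≢ 1+b<a)) (n≤1+n b))
  ... | no 1+b≢x = 1+n≰n (covered (suc b) (s≤s z≤n) (<⇒≤ 1+b<a) 1+b≢x)

isRemoval⇒addsCell : ∀ {P} → IsRemoval D P D⁻ → ∃[ k ] AddsCell k D⁻ D
isRemoval⇒addsCell {P = x , zero}  ((_ , () , _) , _)
isRemoval⇒addsCell {D} {D⁻} {P = x , suc k} ((1≤x , _ , x≤top) , same-cells) = k , addsCell grown unchanged
  where
  removed : ∀ {z i} → 1 ≤ z → z ≤ col D⁻ i → z ≤ col D i × (z , suc i) ≢ (x , suc k)
  removed 1≤z z≤h with proj₁ (same-cells _) (1≤z , s≤s z≤n , z≤h)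
  ... | (_ , _ , z≤h′) , ≢P = z≤h′ , ≢P
  kept : ∀ {z i} → 1 ≤ z → z ≤ col D i → (z , suc i) ≢ (x , suc k) → z ≤ col D⁻ i
  kept 1≤z z≤h ≢P = proj₂ (proj₂ (proj₂ (same-cells _) ((1≤z , s≤s z≤n , z≤h) , ≢P)))
  grown : col D k ≡ suc (col D⁻ k)
  grown = punctured-segment 1≤x x≤top
    (λ z 1≤z z≤h z≡x → proj₂ (removed 1≤z z≤h) (cong (_, suc k) z≡x))
    (λ z 1≤z z≤h z≢x → kept 1≤z z≤h (z≢x ∘ cong proj₁))
  unchanged : ∀ i → i ≢ k → col D i ≡ col D⁻ i
  unchanged i i≢k = ≤-antisym
    (segment-⊆⇒≤ λ z 1≤z z≤h → kept 1≤z z≤h (i≢k ∘ suc-injective ∘ cong proj₂))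
    (segment-⊆⇒≤ λ z 1≤z z≤h → proj₁ (removed 1≤z z≤h))

addsCell⇒isRemoval : AddsCell k D⁻ D → IsRemoval D (col D k , suc k) D⁻
addsCell⇒isRemoval {k} {D⁻} {D} (addsCell grown same) = top∈D , λ Q → removed Q , kept Q
  where
  top∈D : (col D k , suc k) ∈D D
  top∈D = subst (1 ≤_) (sym grown) (s≤s z≤n) , s≤s z≤n , ≤-refl
  removed : ∀ Q → Q ∈D D⁻ → Q ∈D D × Q ≢ (col D k , suc k)
  removed (z , zero)  (_ , () , _)
  removed (z , suc i) (1≤z , _ , z≤h) with i ≟ k
  ... | yes refl = (1≤z , s≤s z≤n , ≤-trans (m≤n⇒m≤1+n z≤h) (≤-reflexive (sym grown))) ,
                   λ Q≡top → 1+n≰n (subst (_≤ col D⁻ i) (trans (cong proj₁ Q≡top) grown) z≤h)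
  ... | no i≢k   = (1≤z , s≤s z≤n , subst (z ≤_) (sym (same i i≢k)) z≤h) , i≢k ∘ suc-injective ∘ cong proj₂
  kept : ∀ Q → Q ∈D D × Q ≢ (col D k , suc k) → Q ∈D D⁻
  kept (z , zero)  ((_ , () , _) , _)
  kept (z , suc i) ((1≤z , _ , z≤h) , ≢top) with i ≟ k
  ... | yes refl = 1≤z , s≤s z≤n , s≤s⁻¹ (subst (z <_) grown (≤∧≢⇒< z≤h (≢top ∘ cong (_, suc i))))
  ... | no i≢k   = 1≤z , s≤s z≤n , subst (z ≤_) (same i i≢k) z≤h

-- Counting cells

count : ℕ → ℕ → List Cell → ℕ
count j d cs = length (filter (νpred j d) cs)

-- Stated exactly as the predicate decided by νpred j d, so that filter-accept/-reject apply.
Counted : ℕ → ℕ → Cell → Set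
Counted j d P = proj₁ P ≥ d ∸ j × proj₂ P ≥ suc j

column : ℕ → ℕ → List Cell
column y c = applyUpTo (λ i → (suc i , y)) c

count-++ : ∀ xs ys → count j d (xs ++ ys) ≡ count j d xs + count j d ys
count-++ {j} {d} xs ys = trans (cong length (filter-++ (νpred j d) xs ys)) (length-++ (filter (νpred j d) xs))

count-counted : ∀ j d P → Counted j d P → count j d [ P ] ≡ 1
count-counted j d P counted = cong length (filter-accept (νpred j d) counted)

count-uncounted : ∀ j d P → ¬ Counted j d P → count j d [ P ] ≡ 0
count-uncounted j d P uncounted = cong length (filter-reject (νpred j d) uncounted)

count-column-suc : ∀ y c → count j d (column y (suc c)) ≡ count j d (column y c) + count j d [ (suc c , y) ]
count-column-suc y c =
  trans (cong (count _ _) (sym (applyUpTo-∷ʳ (λ i → (suc i , y)) c))) (count-++ (column y c) _)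

count-column : d ∸ j ≡ suc m → suc j ≤ y → ∀ c → count j d (column y c) ≡ c ∸ m
count-column {m = m} _ _ zero = sym (0∸n≡0 m)
count-column {d} {j} {m} {y} d∸j≡1+m j<y (suc c) with m ≤? c
... | yes m≤c = begin
  count j d (column y (suc c))                       ≡⟨ count-column-suc y c ⟩
  count j d (column y c) + count j d [ (suc c , y) ]
    ≡⟨ cong₂ _+_ (count-column d∸j≡1+m j<y c) (count-counted j d _ top-counted) ⟩
  c ∸ m + 1                                          ≡⟨ +-comm (c ∸ m) 1 ⟩
  suc (c ∸ m)                                        ≡⟨ +-∸-assoc 1 m≤c ⟨
  suc c ∸ m                                          ∎
  where
  open ≡-Reasoning
  top-counted : Counted j d (suc c , y)
  top-counted = subst (_≤ suc c) (sym d∸j≡1+m) (s≤s m≤c) , j<y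
... | no m≰c = begin
  count j d (column y (suc c))                       ≡⟨ count-column-suc y c ⟩
  count j d (column y c) + count j d [ (suc c , y) ]
    ≡⟨ cong₂ _+_ (count-column d∸j≡1+m j<y c) (count-uncounted j d _ top-uncounted) ⟩
  c ∸ m + 0                                          ≡⟨ cong (_+ 0) (m≤n⇒m∸n≡0 (<⇒≤ (≰⇒> m≰c))) ⟩
  0                                                  ≡⟨ m≤n⇒m∸n≡0 (≰⇒> m≰c) ⟨
  suc c ∸ m                                          ∎
  where
  open ≡-Reasoning
  top-uncounted : ¬ Counted j d (suc c , y)
  top-uncounted (d∸j≤1+c , _) = m≰c (s≤s⁻¹ (subst (_≤ suc c) d∸j≡1+m d∸j≤1+c))

count-column-left : y ≤ j → ∀ c → count j d (column y c) ≡ 0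
count-column-left                   y≤j zero    = refl
count-column-left {y = y} {j} {d} y≤j (suc c) =
  trans (count-column-suc y c)
        (cong₂ _+_ (count-column-left y≤j c) (count-uncounted j d _ (λ (_ , j<y) → <⇒≱ j<y y≤j)))

cellsFrom-++ : ∀ y xs ys →
  count j d (cellsFrom y (xs ++ ys)) ≡ count j d (cellsFrom y xs) + count j d (cellsFrom (length xs + y) ys)
cellsFrom-++         y []       ys = refl
cellsFrom-++ {j} {d} y (c ∷ xs) ys = begin
  count j d (column y c ++ cellsFrom (suc y) (xs ++ ys))
    ≡⟨ count-++ (column y c) (cellsFrom (suc y) (xs ++ ys)) ⟩
  count j d (column y c) + count j d (cellsFrom (suc y) (xs ++ ys))
    ≡⟨ cong (count j d (column y c) +_) (cellsFrom-++ (suc y) xs ys) ⟩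
  count j d (column y c) + (count j d (cellsFrom (suc y) xs) + count j d (cellsFrom (length xs + suc y) ys))
    ≡⟨ +-assoc (count j d (column y c)) _ _ ⟨
  count j d (column y c) + count j d (cellsFrom (suc y) xs) + count j d (cellsFrom (length xs + suc y) ys)
    ≡⟨ cong₂ _+_ (sym (count-++ (column y c) (cellsFrom (suc y) xs)))
                 (cong (λ z → count j d (cellsFrom z ys)) (+-suc (length xs) y)) ⟩
  count j d (column y c ++ cellsFrom (suc y) xs) + count j d (cellsFrom (suc (length xs + y)) ys)
    ∎
  where open ≡-Reasoning

cellsFrom-replicate : ∀ y n → (∀ y′ → y ≤ y′ → count j d (column y′ c) ≡ m) →
  count j d (cellsFrom y (replicate n c)) ≡ n * m
cellsFrom-replicate             y zero    _       = refl
cellsFrom-replicate {j} {d} {c} y (suc n) uniform =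
  trans (count-++ (column y c) (cellsFrom (suc y) (replicate n c)))
        (cong₂ _+_ (uniform y ≤-refl) (cellsFrom-replicate (suc y) n (λ y′ y<y′ → uniform y′ (<⇒≤ y<y′))))

cellsFrom-addCell : ∀ y k D → k ≤ length D →
  count j d (cellsFrom y (addCell k D)) ≡ count j d [ (suc (col D k) , k + y) ] + count j d (cellsFrom y D)
cellsFrom-addCell {j} {d} y zero [] _ = sym (+-identityʳ (count j d [ (1 , y) ]))
cellsFrom-addCell {j} {d} y zero (c ∷ cs) _ = begin
  count j d (column y (suc c) ++ cellsFrom (suc y) cs)
    ≡⟨ count-++ (column y (suc c)) (cellsFrom (suc y) cs) ⟩
  count j d (column y (suc c)) + count j d (cellsFrom (suc y) cs)
    ≡⟨ cong (_+ count j d (cellsFrom (suc y) cs)) (count-column-suc y c) ⟩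
  count j d (column y c) + top + count j d (cellsFrom (suc y) cs)
    ≡⟨ xy∙z≈y∙xz (count j d (column y c)) top _ ⟩
  top + (count j d (column y c) + count j d (cellsFrom (suc y) cs))
    ≡⟨ cong (top +_) (count-++ (column y c) (cellsFrom (suc y) cs)) ⟨
  top + count j d (column y c ++ cellsFrom (suc y) cs)
    ∎
  where
  open ≡-Reasoning
  top : ℕ
  top = count j d [ (suc c , y) ]
cellsFrom-addCell {j} {d} y (suc k) (c ∷ cs) (s≤s k≤n) = begin
  count j d (column y c ++ cellsFrom (suc y) (addCell k cs))
    ≡⟨ count-++ (column y c) (cellsFrom (suc y) (addCell k cs)) ⟩
  count j d (column y c) + count j d (cellsFrom (suc y) (addCell k cs))
    ≡⟨ cong (count j d (column y c) +_) (cellsFrom-addCell (suc y) k cs k≤n) ⟩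
  count j d (column y c) + (top (k + suc y) + count j d (cellsFrom (suc y) cs))
    ≡⟨ cong (λ z → count j d (column y c) + (top z + count j d (cellsFrom (suc y) cs))) (+-suc k y) ⟩
  count j d (column y c) + (top (suc k + y) + count j d (cellsFrom (suc y) cs))
    ≡⟨ x∙yz≈y∙xz (count j d (column y c)) (top (suc k + y)) _ ⟩
  top (suc k + y) + (count j d (column y c) + count j d (cellsFrom (suc y) cs))
    ≡⟨ cong (top (suc k + y) +_) (count-++ (column y c) (cellsFrom (suc y) cs)) ⟨
  top (suc k + y) + count j d (column y c ++ cellsFrom (suc y) cs)
    ∎
  where
  open ≡-Reasoning
  top : ℕ → ℕ
  top z = count j d [ (suc (col cs k) , z) ]

ν-addCell : ∀ k D → k ≤ length D → ν j (addCell k D) d ≡ count j d [ (suc (col D k) , suc k) ] + ν j D d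
ν-addCell {j} {d} k D k≤n =
  trans (cellsFrom-addCell 1 k D k≤n) (cong (λ y → count j d [ (suc (col D k) , y) ] + ν j D d) (+-comm k 1))

ν-addsCell : IsFerrers D → IsFerrers D⁺ → AddsCell k D D⁺ →
  ν j D⁺ d ≡ count j d [ (col D⁺ k , suc k) ] + ν j D d
ν-addsCell {D} {D⁺} {k} {j} {d} F F⁺@(ni⁺ , _) add = begin
  ν j D⁺ d
    ≡⟨ cong (λ E → ν j E d) (addsCell⇒≡addCell F F⁺ add) ⟩
  ν j (addCell k D) d
    ≡⟨ ν-addCell k D (addsCell⇒≤length (Nonincreasing⇒NonincreasingColumns ni⁺) add) ⟩
  count j d [ (suc (col D k) , suc k) ] + ν j D d
    ≡⟨ cong (λ x → count j d [ (x , suc k) ] + ν j D d) (AddsCell.grown add) ⟨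
  count j d [ (col D⁺ k , suc k) ] + ν j D d
    ∎
  where open ≡-Reasoning

ν-addCell-col : ∀ k D → Addable k D → col D k ≡ x → ∀ {r w} → ν j D d ≡ r + w →
  ν j (addCell k D) d ≡ count j d [ (suc x , suc k) ] + r + w
ν-addCell-col {x} {j} {d} k D addable refl {r} {w} ν≡ =
  trans (ν-addCell k D (addable⇒≤length k D addable)) (trans (cong (top +_) ν≡) (sym (+-assoc top r w)))
  where
  top : ℕ
  top = count j d [ (suc (col D k) , suc k) ]

-- ν_min and irreducibility

νminUpTo≤ν : ∀ k → j ≤ k → νminUpTo D d k ≤ ν j D d
νminUpTo≤ν zero    z≤n   = ≤-refl
νminUpTo≤ν (suc k) j≤1+k with m≤n⇒m<n∨m≡n j≤1+k
... | inj₁ (s≤s j≤k) = ≤-trans (m⊓n≤m _ _) (νminUpTo≤ν k j≤k)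
... | inj₂ refl      = m⊓n≤n _ _

νmin≤ν : ∀ D → j < d → νmin D d ≤ ν j D d
νmin≤ν {d = suc k} _ (s≤s j≤k) = νminUpTo≤ν k j≤k

νminUpTo-mono : ∀ k → (∀ j → j ≤ k → ν j D d ≤ ν j E d) → νminUpTo D d k ≤ νminUpTo E d k
νminUpTo-mono zero    le = le 0 z≤n
νminUpTo-mono (suc k) le = ⊓-mono-≤ (νminUpTo-mono k (λ j j≤k → le j (m≤n⇒m≤1+n j≤k))) (le (suc k) ≤-refl)

νmin-mono : (∀ j → j < d → ν j D d ≤ ν j E d) → νmin D d ≤ νmin E d
νmin-mono {d = zero}  _  = z≤n
νmin-mono {d = suc k} le = νminUpTo-mono k (λ j j≤k → le j (s≤s j≤k))

νminUpTo-suc : ∀ k → (∀ j → j ≤ k → ν j E d ≡ suc (ν j D d)) → νminUpTo E d k ≡ suc (νminUpTo D d k)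
νminUpTo-suc zero    eq = eq 0 z≤n
νminUpTo-suc (suc k) eq = cong₂ _⊓_ (νminUpTo-suc k (λ j j≤k → eq j (m≤n⇒m≤1+n j≤k))) (eq (suc k) ≤-refl)

νmin-addsCell-≤ : IsFerrers D → IsFerrers D⁺ → AddsCell k D D⁺ → νmin D d ≤ νmin D⁺ d
νmin-addsCell-≤ {D} {D⁺} {d = d} F F⁺ add = νmin-mono {d = d} {D = D} {E = D⁺} λ j _ →
  ≤-trans (m≤n+m _ _) (≤-reflexive (sym (ν-addsCell F F⁺ add)))

irreducible-grow : Irreducible D d → IsFerrers D⁺ → AddsCell k D D⁺ → νmin D⁺ d ≡ νmin D d
irreducible-grow {D} {d} {D⁺} irr F⁺ add = decidable-stable (νmin D⁺ d ≟ νmin D d) λ ≢ →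
  irr (D⁺ , F⁺ , inj₂ (_ , addsCell⇒isRemoval add , ≢ ∘ sym))

irreducible-shrink : Irreducible D d → IsFerrers D⁻ → AddsCell k D⁻ D → νmin D⁻ d ≢ νmin D d
irreducible-shrink irr F⁻ add eq = irr (_ , F⁻ , inj₁ (_ , addsCell⇒isRemoval add , eq))

irreducible-intro :
  (∀ {D⁺ k} → IsFerrers D⁺ → AddsCell k D D⁺ → νmin D⁺ d ≡ νmin D d) →
  (∀ {D⁻ k} → IsFerrers D⁻ → AddsCell k D⁻ D → νmin D⁻ d ≢ νmin D d) →
  Irreducible D d
irreducible-intro grow shrink (_ , F′ , inj₁ (_ , removal , eq)) =
  shrink F′ (proj₂ (isRemoval⇒addsCell removal)) eq
irreducible-intro grow shrink (_ , F′ , inj₂ (_ , removal , neq)) =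
  neq (sym (grow F′ (proj₂ (isRemoval⇒addsCell removal))))

irreducible-addCell : ∀ k → Irreducible D d → IsFerrers D → Addable k D → νmin (addCell k D) d ≡ νmin D d
irreducible-addCell {D} {d} k irr F addable =
  irreducible-grow {d = d} irr (addCell-isFerrers k F addable) (addCell-addsCell k D (addable⇒≤length k D addable))

-- Removing a corner cannot raise ν_min, so ν_min = 0 would survive it.
irreducible⇒νmin-positive : Irreducible D d → IsFerrers D → D ≢ [] → 0 < νmin D d
irreducible⇒νmin-positive {D} {d} irr F@(_ , ap) D≢[] with corner-exists ap D≢[]
... | k , corner = n≢0⇒n>0 λ νmin≡0 → irreducible-shrink {d = d} irr F⁻ add
  (trans (n≤0⇒n≡0 (subst (νmin (removeCell k D) d ≤_) νmin≡0 (νmin-addsCell-≤ {d = d} F⁻ F add)))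
         (sym νmin≡0))
  where
  F⁻ : IsFerrers (removeCell k D)
  F⁻ = removeCell-isFerrers k F corner
  add : AddsCell k (removeCell k D) D
  add = removeCell-addsCell k ap corner

-- A cell in row and column ≥ d + 1 is counted by every ν_j, so adding it raises ν_min.
irreducible⇒¬deep-addable : ∀ k → Irreducible D (suc d) → IsFerrers D → Addable k D →
  d ≤ col D k → d ≤ k → ⊥
irreducible⇒¬deep-addable {D} {d} k irr F addable d≤h d≤k =
  1+n≢n (trans (sym (νminUpTo-suc d raised)) (irreducible-addCell {d = suc d} k irr F addable))
  where
  raised : ∀ j → j ≤ d → ν j (addCell k D) (suc d) ≡ suc (ν j D (suc d))
  raised j j≤d = trans (ν-addCell k D (addable⇒≤length k D addable)) (cong (_+ ν j D (suc d))
    (count-counted j (suc d) _ (≤-trans (m∸n≤m (suc d) j) (s≤s d≤h) , s≤s (≤-trans j≤d d≤k))))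

-- Adding a cell missed by a minimal ν_j keeps ν_min, removing one counted by a minimal ν_j lowers it.
irreducible-by-witnesses :
  IsFerrers D →
  (∀ k → Addable k D → ∃[ j ] j < d × ν j D d ≡ νmin D d × ¬ Counted j d (suc (col D k) , suc k)) →
  (∀ k → Corner k D → ∃[ j ] j < d × ν j D d ≡ νmin D d × Counted j d (col D k , suc k)) →
  Irreducible D d
irreducible-by-witnesses {D} {d} F uncounted counted = irreducible-intro {D = D} {d = d} grow shrink
  where
  open ≤-Reasoning
  grow : ∀ {D⁺ k} → IsFerrers D⁺ → AddsCell k D D⁺ → νmin D⁺ d ≡ νmin D d
  grow {D⁺} {k} F⁺@(ni⁺ , _) add
    with uncounted k (addsCell⇒addable (Nonincreasing⇒NonincreasingColumns ni⁺) add)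
  ... | j , j<d , minimal , uncounted-j = ≤-antisym (begin
    νmin D⁺ d                                   ≤⟨ νmin≤ν D⁺ j<d ⟩
    ν j D⁺ d                                    ≡⟨ ν-addsCell F F⁺ add ⟩
    count j d [ (col D⁺ k , suc k) ] + ν j D d  ≡⟨ cong₂ _+_ (count-uncounted j d _ top-uncounted) minimal ⟩
    νmin D d                                    ∎) (νmin-addsCell-≤ {d = d} F F⁺ add)
    where
    top-uncounted : ¬ Counted j d (col D⁺ k , suc k)
    top-uncounted = uncounted-j ∘ subst (λ x → Counted j d (x , suc k)) (AddsCell.grown add)
  shrink : ∀ {D⁻ k} → IsFerrers D⁻ → AddsCell k D⁻ D → νmin D⁻ d ≢ νmin D d
  shrink {D⁻} {k} F⁻@(ni⁻ , _) add νmin≡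
    with counted k (addsCell⇒corner (Nonincreasing⇒NonincreasingColumns ni⁻) add)
  ... | j , j<d , minimal , counted-j = 1+n≰n (begin
    suc (νmin D d)                              ≡⟨ cong suc (sym νmin≡) ⟩
    suc (νmin D⁻ d)                             ≤⟨ s≤s (νmin≤ν D⁻ j<d) ⟩
    suc (ν j D⁻ d)                              ≡⟨ cong (_+ ν j D⁻ d) (sym (count-counted j d _ counted-j)) ⟩
    count j d [ (col D k , suc k) ] + ν j D⁻ d  ≡⟨ sym (ν-addsCell F⁻ F add) ⟩
    ν j D d                                     ≡⟨ minimal ⟩
    νmin D d                                    ∎)

-- Hooks and staircases (d = 3)

LowDescents : List ℕ → Set
LowDescents D = ∀ k → col D (2 + k) < col D (1 + k) → col D (2 + k) ≤ 1

irreducible⇒lowDescents : Irreducible D 3 → IsFerrers D → LowDescents D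
irreducible⇒lowDescents irr F k descent =
  ≮⇒≥ λ 1<h → irreducible⇒¬deep-addable {d = 2} (2 + k) irr F descent 1<h (s≤s (s≤s z≤n))

hook : ℕ → ℕ → List ℕ
hook c s = c ∷ replicate s 1

staircase : ℕ → ℕ → ℕ → ℕ → List ℕ
staircase q p t u = 2 + q ∷ 2 + p ∷ replicate t (2 + p) ++ replicate u 1

ones-tail : Nonincreasing (1 ∷ L) → AllPositive L → L ≡ replicate (length L) 1
ones-tail {[]}              _                 _           = refl
ones-tail {suc zero ∷ L}    (ni-∷ _ ni)       (ap-∷ _ ap) = cong (1 ∷_) (ones-tail ni ap)
ones-tail {suc (suc c) ∷ L} (ni-∷ (s≤s ()) _) _

plateau-tail : Nonincreasing (h ∷ L) → AllPositive L → (∀ k → col L k < col (h ∷ L) k → col L k ≤ 1) →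
  ∃[ t ] ∃[ u ] L ≡ replicate t h ++ replicate u 1
plateau-tail {L = []}    _             _             _   = 0 , 0 , refl
plateau-tail {h} {c ∷ L} (ni-∷ c≤h ni) (ap-∷ 1≤c ap) low with c ≟ h
... | yes refl = let t , u , L≡ = plateau-tail ni ap (low ∘ suc) in suc t , u , cong (c ∷_) L≡
... | no c≢h with ≤-antisym (low 0 (≤∧≢⇒< c≤h c≢h)) 1≤c
...   | refl = 0 , suc (length L) , cong (1 ∷_) (ones-tail ni ap)

lowDescents⇒shape : IsFerrers D → D ≢ [] → LowDescents D →
  (∃[ c ] ∃[ s ] D ≡ hook c s) ⊎ (∃[ q ] ∃[ p ] ∃[ t ] ∃[ u ] p ≤ q × D ≡ staircase q p t u)
lowDescents⇒shape {[]} _ D≢[] _ = contradiction refl D≢[]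
lowDescents⇒shape {c ∷ []} _ _ _ = inj₁ (c , 0 , refl)
lowDescents⇒shape {c ∷ suc zero ∷ L} (ni-∷ _ ni , ap-∷ _ (ap-∷ _ ap)) _ _ =
  inj₁ (c , suc (length L) , cong (λ cs → c ∷ 1 ∷ cs) (ones-tail ni ap))
lowDescents⇒shape {suc (suc q) ∷ suc (suc p) ∷ L} (ni-∷ (s≤s (s≤s p≤q)) ni , ap-∷ _ (ap-∷ _ ap)) _ low =
  let t , u , L≡ = plateau-tail ni ap low in inj₂ (q , p , t , u , p≤q , cong (λ cs → 2 + q ∷ 2 + p ∷ cs) L≡)

col-ones≤1 : ∀ u k → col (replicate u 1) k ≤ 1
col-ones≤1 zero    k       = z≤n
col-ones≤1 (suc u) zero    = ≤-refl
col-ones≤1 (suc u) (suc k) = col-ones≤1 u k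

staircase-lowDescents : ∀ q p t u → LowDescents (staircase q p t u)
staircase-lowDescents q p t u = plateau-descents t
  where
  plateau-descents : ∀ t k →
    col (replicate t (2 + p) ++ replicate u 1) k < col (2 + p ∷ replicate t (2 + p) ++ replicate u 1) k →
    col (replicate t (2 + p) ++ replicate u 1) k ≤ 1
  plateau-descents zero    k       _       = col-ones≤1 u k
  plateau-descents (suc t) zero    h<h     = contradiction h<h (<-irrefl refl)
  plateau-descents (suc t) (suc k) descent = plateau-descents t k descent

staircase-corner₁⇒t≡0 : ∀ q p t u → Corner 1 (staircase q p t u) → t ≡ 0
staircase-corner₁⇒t≡0 q p zero    u _      = refl
staircase-corner₁⇒t≡0 q p (suc t) u corner = contradiction corner (<-irrefl refl)

plateau-nonincreasing : 1 ≤ h → ∀ t u → Nonincreasing (h ∷ replicate t h ++ replicate u 1)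
plateau-nonincreasing 1≤h zero    zero    = ni-[ _ ]
plateau-nonincreasing 1≤h zero    (suc u) = ni-∷ 1≤h (plateau-nonincreasing ≤-refl 0 u)
plateau-nonincreasing 1≤h (suc t) u       = ni-∷ ≤-refl (plateau-nonincreasing 1≤h t u)

plateau-allPositive : 1 ≤ h → ∀ t u → AllPositive (replicate t h ++ replicate u 1)
plateau-allPositive 1≤h zero    zero    = ap-[]
plateau-allPositive 1≤h zero    (suc u) = ap-∷ ≤-refl (plateau-allPositive 1≤h 0 u)
plateau-allPositive 1≤h (suc t) u       = ap-∷ 1≤h (plateau-allPositive 1≤h t u)

staircase-isFerrers : ∀ {q p} t u → p ≤ q → IsFerrers (staircase q p t u)
staircase-isFerrers t u p≤q =
  ni-∷ (s≤s (s≤s p≤q)) (plateau-nonincreasing (s≤s z≤n) t u) ,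
  ap-∷ (s≤s z≤n) (ap-∷ (s≤s z≤n) (plateau-allPositive (s≤s z≤n) t u))

count₀-column : ∀ y c → 1 ≤ y → count 0 3 (column y c) ≡ c ∸ 2
count₀-column y c 1≤y = count-column {d = 3} {j = 0} {m = 2} {y = y} refl 1≤y c

count₁-column : ∀ y c → 2 ≤ y → count 1 3 (column y c) ≡ c ∸ 1
count₁-column y c 2≤y = count-column {d = 3} {j = 1} {m = 1} {y = y} refl 2≤y c

count₂-column : ∀ y c → 3 ≤ y → count 2 3 (column y c) ≡ c
count₂-column y c 3≤y = count-column {d = 3} {j = 2} {m = 0} {y = y} refl 3≤y c

ν₁-hook : ∀ c s → ν 1 (hook c s) 3 ≡ 0
ν₁-hook c s = trans (count-++ {j = 1} {d = 3} (column 1 c) (cellsFrom 2 (replicate s 1)))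
  (cong₂ _+_ (count-column-left {j = 1} {d = 3} ≤-refl c)
             (trans (cellsFrom-replicate 2 s (λ y 2≤y → count₁-column y 1 2≤y)) (*-zeroʳ s)))

ν-staircase : ∀ j q p t u {a b} →
  (∀ y → 3 ≤ y → count j 3 (column y (2 + p)) ≡ a) → (∀ y → 3 ≤ y → count j 3 (column y 1) ≡ b) →
  ν j (staircase q p t u) 3 ≡ count j 3 (column 1 (2 + q)) + (count j 3 (column 2 (2 + p)) + (t * a + u * b))
ν-staircase j q p t u {a} {b} plateau ones = begin
  count j 3 (column 1 (2 + q) ++ column 2 (2 + p) ++ cellsFrom 3 tail)
    ≡⟨ count-++ {j = j} {d = 3} (column 1 (2 + q)) (column 2 (2 + p) ++ cellsFrom 3 tail) ⟩
  count j 3 (column 1 (2 + q)) + count j 3 (column 2 (2 + p) ++ cellsFrom 3 tail)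
    ≡⟨ cong (count j 3 (column 1 (2 + q)) +_) (count-++ {j = j} {d = 3} (column 2 (2 + p)) (cellsFrom 3 tail)) ⟩
  count j 3 (column 1 (2 + q)) + (count j 3 (column 2 (2 + p)) + count j 3 (cellsFrom 3 tail))
    ≡⟨ cong (λ z → count j 3 (column 1 (2 + q)) + (count j 3 (column 2 (2 + p)) + z)) count-tail ⟩
  count j 3 (column 1 (2 + q)) + (count j 3 (column 2 (2 + p)) + (t * a + u * b))
    ∎
  where
  open ≡-Reasoning
  tail : List ℕ
  tail = replicate t (2 + p) ++ replicate u 1
  count-tail : count j 3 (cellsFrom 3 tail) ≡ t * a + u * b
  count-tail = trans (cellsFrom-++ 3 (replicate t (2 + p)) (replicate u 1))
    (cong₂ _+_ (cellsFrom-replicate 3 t plateau)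
               (cellsFrom-replicate _ u (λ y le → ones y (≤-trans (m≤n+m 3 (length (replicate t (2 + p)))) le))))

ν₀-staircase : ∀ q p t u → ν 0 (staircase q p t u) 3 ≡ q + p + t * p
ν₀-staircase q p t u = trans
  (ν-staircase 0 q p t u (λ y 3≤y → count₀-column y (2 + p) (≤-trans (s≤s z≤n) 3≤y))
                         (λ y 3≤y → count₀-column y 1 (≤-trans (s≤s z≤n) 3≤y)))
  (trans (cong₂ _+_ (count₀-column 1 (2 + q) ≤-refl) (cong (_+ (t * p + u * 0)) (count₀-column 2 (2 + p) (s≤s z≤n))))
         (normalise q p t u))
  where
  normalise : ∀ q p t u → q + (p + (t * p + u * 0)) ≡ q + p + t * p
  normalise = solve-∀

ν₁-staircase : ∀ q p t u → ν 1 (staircase q p t u) 3 ≡ suc (p + t) + t * p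
ν₁-staircase q p t u = trans
  (ν-staircase 1 q p t u (λ y 3≤y → count₁-column y (2 + p) (≤-trans (s≤s (s≤s z≤n)) 3≤y))
                         (λ y 3≤y → count₁-column y 1 (≤-trans (s≤s (s≤s z≤n)) 3≤y)))
  (trans (cong₂ _+_ (count-column-left {j = 1} {d = 3} ≤-refl (2 + q))
                    (cong (_+ (t * suc p + u * 0)) (count₁-column 2 (2 + p) ≤-refl)))
         (normalise p t u))
  where
  normalise : ∀ p t u → 0 + (suc p + (t * suc p + u * 0)) ≡ suc (p + t) + t * p
  normalise = solve-∀

ν₂-staircase : ∀ q p t u → ν 2 (staircase q p t u) 3 ≡ t + t + u + t * p
ν₂-staircase q p t u = trans
  (ν-staircase 2 q p t u (λ y 3≤y → count₂-column y (2 + p) 3≤y) (λ y 3≤y → count₂-column y 1 3≤y))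
  (trans (cong₂ _+_ (count-column-left {j = 2} {d = 3} (s≤s z≤n) (2 + q))
                    (cong (_+ (t * (2 + p) + u * 1)) (count-column-left {j = 2} {d = 3} (s≤s (s≤s z≤n)) (2 + p))))
         (normalise p t u))
  where
  normalise : ∀ p t u → 0 + (0 + (t * (2 + p) + u * 1)) ≡ t + t + u + t * p
  normalise = solve-∀

νmin₃ : ∀ E a b c w → ν 0 E 3 ≡ a + w → ν 1 E 3 ≡ b + w → ν 2 E 3 ≡ c + w → νmin E 3 ≡ a ⊓ b ⊓ c + w
νmin₃ E a b c w ν₀≡ ν₁≡ ν₂≡ = begin
  ν 0 E 3 ⊓ ν 1 E 3 ⊓ ν 2 E 3  ≡⟨ cong₂ _⊓_ (cong₂ _⊓_ ν₀≡ ν₁≡) ν₂≡ ⟩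
  (a + w) ⊓ (b + w) ⊓ (c + w)  ≡⟨ cong (_⊓ (c + w)) (+-distribʳ-⊓ w a b) ⟨
  (a ⊓ b + w) ⊓ (c + w)        ≡⟨ +-distribʳ-⊓ w (a ⊓ b) c ⟨
  a ⊓ b ⊓ c + w                ∎
  where open ≡-Reasoning

νmin-staircase : ∀ q p t u → νmin (staircase q p t u) 3 ≡ (q + p) ⊓ suc (p + t) ⊓ (t + t + u) + t * p
νmin-staircase q p t u = νmin₃ (staircase q p t u) (q + p) (suc (p + t)) (t + t + u) (t * p)
  (ν₀-staircase q p t u) (ν₁-staircase q p t u) (ν₂-staircase q p t u)

-- Moves on staircases

addsCell-ones : ∀ u → AddsCell u (replicate u 1) (replicate (suc u) 1)
addsCell-ones zero    = addsCell-[]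
addsCell-ones (suc u) = addsCell-∷ (addsCell-ones u)

addsCell-replicate-++ : ∀ n → AddsCell k D E → AddsCell (n + k) (replicate n h ++ D) (replicate n h ++ E)
addsCell-replicate-++ zero    add = add
addsCell-replicate-++ (suc n) add = addsCell-∷ (addsCell-replicate-++ n add)

staircase-addsCell-one : ∀ q p t u → AddsCell (2 + (t + u)) (staircase q p t u) (staircase q p t (suc u))
staircase-addsCell-one q p t u = addsCell-∷ (addsCell-∷ (addsCell-replicate-++ t (addsCell-ones u)))

col-replicate-++ : ∀ n → col (replicate n h ++ D) n ≡ col D 0
col-replicate-++ zero    = refl
col-replicate-++ (suc n) = col-replicate-++ n

col-plateau : ∀ n → col (h ∷ replicate n h ++ D) n ≡ h
col-plateau zero    = refl
col-plateau (suc n) = col-plateau n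

⊓-sucˡ-≡⇒≥ : suc m ⊓ n ≡ m ⊓ n → n ≤ m
⊓-sucˡ-≡⇒≥ {m} {n} eq with m <? n
... | yes m<n = contradiction (trans (sym (m≤n⇒m⊓n≡m m<n)) (trans eq (m≤n⇒m⊓n≡m (<⇒≤ m<n)))) 1+n≢n
... | no m≮n  = ≮⇒≥ m≮n

⊓-sucˡ-≢⇒< : m ⊓ n ≢ suc m ⊓ n → m < n
⊓-sucˡ-≢⇒< {m} {n} neq with n ≤? m
... | yes n≤m = contradiction (trans (m≥n⇒m⊓n≡n n≤m) (sym (m≥n⇒m⊓n≡n (m≤n⇒m≤1+n n≤m)))) neq
... | no n≰m  = ≰⇒> n≰m

staircase-grow : ∀ {q p t u q′ u′ k} → p ≤ q′ → Irreducible (staircase q p t u) 3 →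
  AddsCell k (staircase q p t u) (staircase q′ p t u′) →
  (q′ + p) ⊓ suc (p + t) ⊓ (t + t + u′) ≡ (q + p) ⊓ suc (p + t) ⊓ (t + t + u)
staircase-grow {q} {p} {t} {u} {q′} {u′} p≤q′ irr add = +-cancelʳ-≡ (t * p) _ _
  (trans (sym (νmin-staircase q′ p t u′))
         (trans (irreducible-grow {d = 3} irr (staircase-isFerrers t u′ p≤q′) add) (νmin-staircase q p t u)))

staircase-shrink : ∀ {q p t u q′ u′ k} → p ≤ q → Irreducible (staircase q′ p t u′) 3 →
  AddsCell k (staircase q p t u) (staircase q′ p t u′) →
  (q + p) ⊓ suc (p + t) ⊓ (t + t + u) ≢ (q′ + p) ⊓ suc (p + t) ⊓ (t + t + u′)
staircase-shrink {q} {p} {t} {u} {q′} {u′} p≤q irr add eq =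
  irreducible-shrink {d = 3} irr (staircase-isFerrers t u p≤q) add
    (trans (νmin-staircase q p t u) (trans (cong (_+ t * p) eq) (sym (νmin-staircase q′ p t u′))))

staircase-addCell : ∀ q p t u k → p ≤ q → Irreducible (staircase q p t u) 3 →
  Addable k (staircase q p t u) → col (staircase q p t u) k ≡ x →
  let P = (suc x , suc k) in
  (count 0 3 [ P ] + (q + p)) ⊓ (count 1 3 [ P ] + suc (p + t)) ⊓ (count 2 3 [ P ] + (t + t + u))
    ≡ (q + p) ⊓ suc (p + t) ⊓ (t + t + u)
staircase-addCell {x} q p t u k p≤q irr addable col≡x = +-cancelʳ-≡ (t * p) _ _ (trans
  (sym (νmin₃ (addCell k S) _ _ _ (t * p)
    (shift (ν₀-staircase q p t u)) (shift (ν₁-staircase q p t u)) (shift (ν₂-staircase q p t u))))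
  (trans (irreducible-addCell {d = 3} k irr (staircase-isFerrers t u p≤q) addable) (νmin-staircase q p t u)))
  where
  S : List ℕ
  S = staircase q p t u
  shift : ∀ {j r} → ν j S 3 ≡ r + t * p → ν j (addCell k S) 3 ≡ count j 3 [ (suc x , suc k) ] + r + t * p
  shift = ν-addCell-col k S addable col≡x

grow-first-column : ∀ q p t u → p ≤ q → Irreducible (staircase q p t u) 3 → suc (p + t) ⊓ (t + t + u) ≤ q + p
grow-first-column q p t u p≤q irr = ⊓-sucˡ-≡⇒≥ (begin
  suc (q + p) ⊓ (suc (p + t) ⊓ (t + t + u)) ≡⟨ ⊓-assoc (suc (q + p)) _ _ ⟨
  suc (q + p) ⊓ suc (p + t) ⊓ (t + t + u)   ≡⟨ staircase-grow (m≤n⇒m≤1+n p≤q) irr addsCell-head ⟩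
  (q + p) ⊓ suc (p + t) ⊓ (t + t + u)       ≡⟨ ⊓-assoc (q + p) _ _ ⟩
  (q + p) ⊓ (suc (p + t) ⊓ (t + t + u))     ∎)
  where open ≡-Reasoning

shrink-first-column : ∀ q p t u → p ≤ q → Irreducible (staircase (suc q) p t u) 3 →
  suc (q + p) ≤ suc (p + t) ⊓ (t + t + u)
shrink-first-column q p t u p≤q irr = ⊓-sucˡ-≢⇒< λ eq →
  staircase-shrink p≤q irr addsCell-head (trans (⊓-assoc (q + p) _ _) (trans eq (sym (⊓-assoc (suc (q + p)) _ _))))

grow-second-column : ∀ q p t u → p < q → Irreducible (staircase q p t u) 3 → t + t + u ≤ (q + p) ⊓ suc (p + t)
grow-second-column q p t u p<q irr = ⊓-sucˡ-≡⇒≥ (staircase-addCell q p t u 1 (<⇒≤ p<q) irr (s≤s (s≤s p<q)) refl)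

grow-new-column : ∀ q p t u → p ≤ q → Irreducible (staircase q p t u) 3 → (q + p) ⊓ suc (p + t) ≤ t + t + u
grow-new-column q p t u p≤q irr = ⊓-sucˡ-≡⇒≥ (begin
  suc (t + t + u) ⊓ ((q + p) ⊓ suc (p + t))   ≡⟨ ⊓-comm (suc (t + t + u)) _ ⟩
  (q + p) ⊓ suc (p + t) ⊓ suc (t + t + u)     ≡⟨ cong ((q + p) ⊓ suc (p + t) ⊓_) (+-suc (t + t) u) ⟨
  (q + p) ⊓ suc (p + t) ⊓ (t + t + suc u)     ≡⟨ staircase-grow p≤q irr (staircase-addsCell-one q p t u) ⟩
  (q + p) ⊓ suc (p + t) ⊓ (t + t + u)         ≡⟨ ⊓-comm ((q + p) ⊓ suc (p + t)) _ ⟩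
  (t + t + u) ⊓ ((q + p) ⊓ suc (p + t))       ∎)
  where open ≡-Reasoning

shrink-last-column : ∀ q p t u → p ≤ q → Irreducible (staircase q p t (suc u)) 3 →
  t + t + suc u ≤ (q + p) ⊓ suc (p + t)
shrink-last-column q p t u p≤q irr = subst (_≤ (q + p) ⊓ suc (p + t)) (sym (+-suc (t + t) u)) (⊓-sucˡ-≢⇒< λ eq →
  staircase-shrink p≤q irr (staircase-addsCell-one q p t u) (begin
    (q + p) ⊓ suc (p + t) ⊓ (t + t + u)         ≡⟨ ⊓-comm ((q + p) ⊓ suc (p + t)) _ ⟩
    (t + t + u) ⊓ ((q + p) ⊓ suc (p + t))       ≡⟨ eq ⟩
    suc (t + t + u) ⊓ ((q + p) ⊓ suc (p + t))   ≡⟨ ⊓-comm (suc (t + t + u)) _ ⟩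
    (q + p) ⊓ suc (p + t) ⊓ suc (t + t + u)     ≡⟨ cong ((q + p) ⊓ suc (p + t) ⊓_) (+-suc (t + t) u) ⟨
    (q + p) ⊓ suc (p + t) ⊓ (t + t + suc u)     ∎))
  where open ≡-Reasoning

grow-first-unit-column : ∀ q p t u → p ≤ q → Irreducible (staircase q p t (suc u)) 3 →
  q + p ≤ suc (p + t) ⊓ (t + t + suc u)
grow-first-unit-column q p t u p≤q irr = ⊓-sucˡ-≡⇒≥ (begin
  suc (B ⊓ C) ⊓ A       ≡⟨ ⊓-comm (suc (B ⊓ C)) A ⟩
  A ⊓ suc (B ⊓ C)       ≡⟨ ⊓-assoc A (suc B) (suc C) ⟨
  A ⊓ suc B ⊓ suc C     ≡⟨ staircase-addCell q p t (suc u) (2 + t) p≤q irr addable (col-replicate-++ t) ⟩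
  A ⊓ B ⊓ C             ≡⟨ ⊓-assoc A B C ⟩
  A ⊓ (B ⊓ C)           ≡⟨ ⊓-comm A (B ⊓ C) ⟩
  B ⊓ C ⊓ A             ∎)
  where
  open ≡-Reasoning
  A B C : ℕ
  A = q + p
  B = suc (p + t)
  C = t + t + suc u
  addable : Addable (2 + t) (staircase q p t (suc u))
  addable = subst₂ _<_ (sym (col-replicate-++ t)) (sym (col-plateau t)) (s≤s (s≤s z≤n))

-- Balanced staircases

-- ν₀ = ν₂ ≤ ν₁ on staircase q p t u, after cancelling the summand t * p common to all three.
Balanced : ℕ → ℕ → ℕ → ℕ → Set
Balanced q p t u = q + p ≡ t + t + u × q + p ≤ suc (p + t)

⊓-squeeze : ∀ {a b c} → a ≤ b ⊓ c → c ≤ a ⊓ b → a ≡ c × a ≤ b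
⊓-squeeze {a} {b} {c} a≤b⊓c c≤a⊓b =
  ≤-antisym (≤-trans a≤b⊓c (m⊓n≤n b c)) (≤-trans c≤a⊓b (m⊓n≤m a b)) , ≤-trans a≤b⊓c (m⊓n≤m b c)

⊓-≤-sel : ∀ {a b c} → a ⊓ b ≤ c → a ≤ c ⊎ b ≤ c
⊓-≤-sel {a} {b} a⊓b≤c with ⊓-sel a b
... | inj₁ a⊓b≡a = inj₁ (subst (_≤ _) a⊓b≡a a⊓b≤c)
... | inj₂ a⊓b≡b = inj₂ (subst (_≤ _) a⊓b≡b a⊓b≤c)

m+m≤n+n⇒m≤n : m + m ≤ n + n → m ≤ n
m+m≤n+n⇒m≤n le = ≮⇒≥ λ n<m → <⇒≱ (+-mono-< n<m n<m) le

rectangle-moves⇒square : ∀ p t →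
  suc (p + t) ⊓ (t + t + 0) ≤ p + p → (p + p) ⊓ suc (p + t) ≤ t + t + 0 → p ≡ t
rectangle-moves⇒square p t grow-first grow-new =
  ≤-antisym (p≤t (⊓-≤-sel grow-new)) (t≤p (⊓-≤-sel grow-first))
  where
  t≤p : suc (p + t) ≤ p + p ⊎ t + t + 0 ≤ p + p → t ≤ p
  t≤p (inj₁ le) = <⇒≤ (+-cancelˡ-≤ p (suc t) p (subst (_≤ p + p) (sym (+-suc p t)) le))
  t≤p (inj₂ le) = m+m≤n+n⇒m≤n (subst (_≤ p + p) (+-identityʳ (t + t)) le)
  p≤t : p + p ≤ t + t + 0 ⊎ suc (p + t) ≤ t + t + 0 → p ≤ t
  p≤t (inj₁ le) = m+m≤n+n⇒m≤n (subst (p + p ≤_) (+-identityʳ (t + t)) le)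
  p≤t (inj₂ le) = <⇒≤ (+-cancelʳ-≤ t (suc p) t (subst (suc (p + t) ≤_) (+-identityʳ (t + t)) le))

irreducible⇒balanced : ∀ q p t u → p ≤ q → Irreducible (staircase q p t u) 3 → Balanced q p t u
irreducible⇒balanced q p t (suc u) p≤q irr =
  ⊓-squeeze (grow-first-unit-column q p t u p≤q irr) (shrink-last-column q p t u p≤q irr)
irreducible⇒balanced q p t zero p≤q irr with m≤n⇒m<n∨m≡n p≤q
... | inj₁ (s≤s {n = q′} p≤q′) =
  ⊓-squeeze (shrink-first-column q′ p t 0 p≤q′ irr) (grow-second-column q p t 0 (s≤s p≤q′) irr)
... | inj₂ refl
  with rectangle-moves⇒square p t (grow-first-column p p t 0 ≤-refl irr) (grow-new-column p p t 0 ≤-refl irr)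
...   | refl = sym (+-identityʳ _) , n≤1+n _

balanced⇒νmin : ∀ q p t u → Balanced q p t u → νmin (staircase q p t u) 3 ≡ q + p + t * p
balanced⇒νmin q p t u (A≡C , A≤B) = trans (νmin-staircase q p t u)
  (cong (_+ t * p) (trans (cong₂ _⊓_ (m≤n⇒m⊓n≡m A≤B) (sym A≡C)) (⊓-idem (q + p))))

-- Staircase parameters of 𝒜 (3 + k), 𝒢 (3 + k), ℰ (4 + k), ℱ (4 + k); only 𝒜 and ℱ need a ++ [] rewrite.
data FamilyStaircase : ℕ → ℕ → ℕ → ℕ → Set where
  is𝒜 : ∀ k → FamilyStaircase (suc k) (suc k) (suc k) 0
  is𝒢 : ∀ k → FamilyStaircase (suc k) k k 1
  isℰ : ∀ k → FamilyStaircase (suc k) (suc k) k 2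
  isℱ : ∀ k → FamilyStaircase (2 + k) k (suc k) 0

𝒜≡staircase : ∀ k → 𝒜 (3 + k) ≡ staircase (suc k) (suc k) (suc k) 0
𝒜≡staircase k = cong (λ cs → 3 + k ∷ 3 + k ∷ cs) (sym (++-identityʳ (replicate (suc k) (3 + k))))

ℱ≡staircase : ∀ k → ℱ (4 + k) ≡ staircase (2 + k) k (suc k) 0
ℱ≡staircase k = cong (λ cs → 4 + k ∷ 2 + k ∷ cs) (sym (++-identityʳ (replicate (suc k) (2 + k))))

familyStaircase⇒InFamily : ∀ {q p t u} → FamilyStaircase q p t u → InFamily (staircase q p t u)
familyStaircase⇒InFamily (is𝒜 k) = inj₁ (3 + k , s≤s (s≤s (s≤s z≤n)) , inj₁ (sym (𝒜≡staircase k)))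
familyStaircase⇒InFamily (is𝒢 k) = inj₁ (3 + k , s≤s (s≤s (s≤s z≤n)) , inj₂ refl)
familyStaircase⇒InFamily (isℰ k) = inj₂ (4 + k , s≤s (s≤s (s≤s (s≤s z≤n))) , inj₁ refl)
familyStaircase⇒InFamily (isℱ k) = inj₂ (4 + k , s≤s (s≤s (s≤s (s≤s z≤n))) , inj₂ (sym (ℱ≡staircase k)))

InFamily⇒familyStaircase : InFamily D →
  ∃[ q ] ∃[ p ] ∃[ t ] ∃[ u ] FamilyStaircase q p t u × D ≡ staircase q p t u
InFamily⇒familyStaircase (inj₁ (_ , s≤s (s≤s (s≤s (z≤n {k}))) , inj₁ refl)) =
  _ , _ , _ , _ , is𝒜 k , 𝒜≡staircase k
InFamily⇒familyStaircase (inj₁ (_ , s≤s (s≤s (s≤s (z≤n {k}))) , inj₂ refl)) =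
  _ , _ , _ , _ , is𝒢 k , refl
InFamily⇒familyStaircase (inj₂ (_ , s≤s (s≤s (s≤s (s≤s (z≤n {k})))) , inj₁ refl)) =
  _ , _ , _ , _ , isℰ k , refl
InFamily⇒familyStaircase (inj₂ (_ , s≤s (s≤s (s≤s (s≤s (z≤n {k})))) , inj₂ refl)) =
  _ , _ , _ , _ , isℱ k , ℱ≡staircase k

square-parameters : ∀ {q p t u} → p ≤ q → q ≤ t → q + p ≡ t + t + u → q ≡ t × p ≡ t × u ≡ 0
square-parameters {q} {p} {t} {u} p≤q q≤t A≡C =
  ≤-antisym q≤t (+-cancelʳ-≤ t t q (≤-trans 2t≤q+p (+-monoʳ-≤ q p≤t))) ,
  ≤-antisym p≤t (+-cancelˡ-≤ t t p (≤-trans 2t≤q+p (+-monoˡ-≤ p q≤t))) ,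
  n≤0⇒n≡0 (+-cancelˡ-≤ (t + t) u 0 (begin
    t + t + u  ≡⟨ A≡C ⟨
    q + p      ≤⟨ +-mono-≤ q≤t p≤t ⟩
    t + t      ≡⟨ +-identityʳ (t + t) ⟨
    t + t + 0  ∎))
  where
  open ≤-Reasoning
  p≤t : p ≤ t
  p≤t = ≤-trans p≤q q≤t
  2t≤q+p : t + t ≤ q + p
  2t≤q+p = ≤-trans (m≤m+n (t + t) u) (≤-reflexive (sym A≡C))

step-parameters : ∀ p t u → p ≤ suc t → suc p ≡ u + t → FamilyStaircase (suc t) p t u
step-parameters p t 0                   _     refl = isℱ p
step-parameters p t 1                   _     refl = is𝒢 p
step-parameters p t 2                   _     refl = isℰ t
step-parameters p t (suc (suc (suc u))) p≤1+t refl = contradiction (≤-trans (s≤s⁻¹ p≤1+t) (m≤n+m t u)) 1+n≰n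

-- ν₀ ≤ ν₁ gives q ≤ t + 1.  For q ≤ t the staircase is a square (𝒜); for q = t + 1,
-- ν₀ = ν₂ reads p + 1 = t + u, and p ≤ q leaves u ∈ {0, 1, 2} (ℱ, 𝒢, ℰ).
balanced⇒familyStaircase : ∀ q p t u → p ≤ q → 0 < q + p + t * p → Balanced q p t u → FamilyStaircase q p t u
balanced⇒familyStaircase q p t u p≤q ν₀>0 (A≡C , A≤B)
  with m≤n⇒m<n∨m≡n (+-cancelʳ-≤ p q (suc t) (subst (q + p ≤_) (cong suc (+-comm p t)) A≤B))
... | inj₁ (s≤s q≤t) with square-parameters p≤q q≤t A≡C
...   | refl , refl , refl = square t ν₀>0
  where
  square : ∀ t → 0 < t + t + t * t → FamilyStaircase t t t 0
  square (suc k) _ = is𝒜 k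
balanced⇒familyStaircase q p t u p≤q ν₀>0 (A≡C , A≤B) | inj₂ refl =
  step-parameters p t u p≤q (+-cancelˡ-≡ t (suc p) (u + t) (begin
    t + suc p     ≡⟨ +-suc t p ⟩
    suc t + p     ≡⟨ A≡C ⟩
    t + t + u     ≡⟨ +-assoc t t u ⟩
    t + (t + u)   ≡⟨ cong (t +_) (+-comm t u) ⟩
    t + (u + t)   ∎))
  where open ≡-Reasoning

familyStaircase⇒balanced : ∀ {q p t u} → FamilyStaircase q p t u → Balanced q p t u
familyStaircase⇒balanced (is𝒜 k) = sym (+-identityʳ _) , n≤1+n _
familyStaircase⇒balanced (is𝒢 k) = +-comm 1 (k + k) , ≤-refl
familyStaircase⇒balanced (isℰ k) = sides k , ≤-reflexive (cong suc (+-suc k k))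
  where
  sides : ∀ k → suc k + suc k ≡ k + k + 2
  sides = solve-∀
familyStaircase⇒balanced (isℱ k) = sides k , ≤-reflexive (cong suc (sym (+-suc k k)))
  where
  sides : ∀ k → 2 + k + k ≡ suc k + suc k + 0
  sides = solve-∀

familyStaircase-t≡0⇒1+p+t≡q+p : ∀ {q p t u} → FamilyStaircase q p t u → t ≡ 0 → suc (p + t) ≡ q + p
familyStaircase-t≡0⇒1+p+t≡q+p (is𝒢 k) _    = refl
familyStaircase-t≡0⇒1+p+t≡q+p (isℰ k) refl = refl

familyStaircase⇒irreducible : ∀ q p t u → IsFerrers (staircase q p t u) → FamilyStaircase q p t u →
  Irreducible (staircase q p t u) 3
familyStaircase⇒irreducible q p t u F fam = irreducible-by-witnesses F addable-witness corner-witness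
  where
  S : List ℕ
  S = staircase q p t u
  balanced : Balanced q p t u
  balanced = familyStaircase⇒balanced fam
  minimal₀ : ν 0 S 3 ≡ νmin S 3
  minimal₀ = trans (ν₀-staircase q p t u) (sym (balanced⇒νmin q p t u balanced))
  minimal₁ : t ≡ 0 → ν 1 S 3 ≡ νmin S 3
  minimal₁ t≡0 = trans (ν₁-staircase q p t u)
    (trans (cong (_+ t * p) (familyStaircase-t≡0⇒1+p+t≡q+p fam t≡0)) (sym (balanced⇒νmin q p t u balanced)))
  minimal₂ : ν 2 S 3 ≡ νmin S 3
  minimal₂ = trans (ν₂-staircase q p t u)
    (trans (cong (_+ t * p) (sym (proj₁ balanced))) (sym (balanced⇒νmin q p t u balanced)))
  addable-witness : ∀ k → Addable k S → ∃[ j ] j < 3 × ν j S 3 ≡ νmin S 3 × ¬ Counted j 3 (suc (col S k) , suc k)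
  addable-witness zero          _       = 2 , ≤-refl , minimal₂ , λ { (_ , s≤s ()) }
  addable-witness (suc zero)    _       = 2 , ≤-refl , minimal₂ , λ { (_ , s≤s (s≤s ())) }
  addable-witness (suc (suc k)) descent =
    0 , s≤s z≤n , minimal₀ , λ (3≤h , _) → <⇒≱ (s≤s (s≤s (staircase-lowDescents q p t u k descent))) 3≤h
  corner-witness : ∀ k → Corner k S → ∃[ j ] j < 3 × ν j S 3 ≡ νmin S 3 × Counted j 3 (col S k , suc k)
  corner-witness zero          corner = 0 , s≤s z≤n , minimal₀ , ≤-trans (s≤s (s≤s (s≤s z≤n))) corner , s≤s z≤n
  corner-witness (suc zero)    corner =
    1 , s≤s (s≤s z≤n) , minimal₁ (staircase-corner₁⇒t≡0 q p t u corner) , s≤s (s≤s z≤n) , s≤s (s≤s z≤n)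
  corner-witness (suc (suc k)) corner = 2 , ≤-refl , minimal₂ , ≤-trans (s≤s z≤n) corner , s≤s (s≤s (s≤s z≤n))

theorem6p1 : (D : List ℕ) → IsFerrers D → D ≢ [] →
    (Irreducible D 3 → InFamily D) × (InFamily D → Irreducible D 3)
theorem6p1 D F D≢[] = irreducible⇒InFamily , InFamily⇒irreducible
  where
  positive : Irreducible D 3 → 0 < νmin D 3
  positive irr = irreducible⇒νmin-positive {d = 3} irr F D≢[]
  irreducible⇒InFamily : Irreducible D 3 → InFamily D
  irreducible⇒InFamily irr with lowDescents⇒shape F D≢[] (irreducible⇒lowDescents irr F)
  ... | inj₁ (c , s , refl) = contradiction (sym (ν₁-hook c s))
    (<⇒≢ (≤-trans (positive irr) (νmin≤ν {d = 3} (hook c s) (s≤s (s≤s z≤n)))))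
  ... | inj₂ (q , p , t , u , p≤q , refl) = familyStaircase⇒InFamily (balanced⇒familyStaircase q p t u p≤q
    (subst (0 <_) (ν₀-staircase q p t u) (≤-trans (positive irr) (νmin≤ν {d = 3} (staircase q p t u) (s≤s z≤n))))
    (irreducible⇒balanced q p t u p≤q irr))
  InFamily⇒irreducible : InFamily D → Irreducible D 3
  InFamily⇒irreducible family with InFamily⇒familyStaircase family
  ... | q , p , t , u , fam , refl = familyStaircase⇒irreducible q p t u F fam
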